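{- Let $\Gamma=(S,R)$ be a finite tree with a perfect matching $\mathcal P$. For each $s\in S$, $\theta(\alpha_s^\vee)=f_s$.
   Context: $V$ is the $\mathbb F_2$-vector space with basis $\{\alpha_s\mid s\in S\}$, $V^*$ its dual with dual basis $\{f_s\}$ ($f_s(\alpha_t)=1$ iff $s=t$). $B$ is the bilinear form with $B(\alpha_s,\alpha_t)=1$ if $st\in R$ and $0$ otherwise, and $\theta:V\to V^*$ is $\theta(\alpha)(\beta)=B(\alpha,\beta)$. For $s\in S$, $A_s$ is the set of $t\in S\setminus\{s\}$ such that the path in $\Gamma$ from $s$ to $t$ is alternating (edges alternately in and not in $\mathcal P$) with first and last edges in $\mathcal P$, and $\alpha_s^\vee=\sum_{t\in A_s}\alpha_t$. -}

module Defs where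

open import Data.Bool using (Bool; true; false; not; _∧_; _xor_)
open import Data.Nat using (ℕ; zero; suc; _≤_)
open import Data.Fin using (Fin; zero; suc)
open import Data.List using (List; []; _∷_; _++_; length; head; last)
open import Data.List.Relation.Unary.Unique.Propositional using (Unique)
open import Data.Maybe using (just)
open import Data.Product using (Σ; _×_)
open import Data.Unit using (⊤)
open import Data.Empty using (⊥)
open import Relation.Binary.PropositionalEquality using (_≡_; _≢_)
open import Relation.Nullary using (¬_)

-- A simple graph Γ = (S, R) on the vertex set S = Fin n is given by its
-- adjacency function: E s t ≡ true  iff  {s,t} ∈ R  (i.e. "st ∈ R").
Rel : ℕ → Set
Rel n = Fin n → Fin n → Bool

module _ {n : ℕ} where

  IsSimpleGraph : Rel n → Set
  IsSimpleGraph E = (∀ s t → E s t ≡ E t s) × (∀ s → E s s ≡ false)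

  Consecutive : Rel n → List (Fin n) → Set
  Consecutive E []           = ⊤
  Consecutive E (x ∷ [])     = ⊤
  Consecutive E (x ∷ y ∷ xs) = (E x y ≡ true) × Consecutive E (y ∷ xs)

  IsPath : Rel n → Fin n → Fin n → List (Fin n) → Set
  IsPath E s t p = Unique p × Consecutive E p × head p ≡ just s × last p ≡ just t

  Connected : Rel n → Set
  Connected E = ∀ s t → Σ (List (Fin n)) (IsPath E s t)

  IsCycle : Rel n → List (Fin n) → Set
  IsCycle E []       = ⊥
  IsCycle E (x ∷ xs) = (3 ≤ length (x ∷ xs)) × Unique (x ∷ xs) × Consecutive E ((x ∷ xs) ++ (x ∷ []))

  Acyclic : Rel n → Set
  Acyclic E = ∀ p → ¬ IsCycle E p

  IsTree : Rel n → Set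
  IsTree E = IsSimpleGraph E × Connected E × Acyclic E

  IsPerfectMatching : Rel n → Rel n → Set
  IsPerfectMatching E P =
    (∀ s t → P s t ≡ P t s) ×
    (∀ s t → P s t ≡ true → E s t ≡ true) ×
    (∀ s → Σ (Fin n) λ t → (P s t ≡ true) × (∀ u → P s u ≡ true → u ≡ t))

  FirstEdgeIn : Rel n → List (Fin n) → Set
  FirstEdgeIn P (x ∷ y ∷ xs) = P x y ≡ true
  FirstEdgeIn P _            = ⊥

  LastEdgeIn : Rel n → List (Fin n) → Set
  LastEdgeIn P (x ∷ y ∷ [])     = P x y ≡ true
  LastEdgeIn P (x ∷ y ∷ z ∷ xs) = LastEdgeIn P (y ∷ z ∷ xs)
  LastEdgeIn P _                = ⊥

  Alternating : Rel n → List (Fin n) → Set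
  Alternating P (x ∷ y ∷ z ∷ xs) = (P x y ≡ not (P y z)) × Alternating P (y ∷ z ∷ xs)
  Alternating P _                = ⊤

  -- t ∈ A_s : t ≠ s and the path in Γ from s to t (unique, as Γ is a tree)
  -- is alternating with first and last edges in P
  InA : Rel n → Rel n → Fin n → Fin n → Set
  InA E P s t = (t ≢ s) × Σ (List (Fin n)) λ p →
    IsPath E s t p × Alternating P p × FirstEdgeIn P p × LastEdgeIn P p

  -- Linear algebra over 𝔽₂ = Bool (xor = +, ∧ = ·).
  -- V = 𝔽₂^S: a vector v is its coordinate function w.r.t. the basis {α_s}.
  -- V* : linear functionals, represented as functions V → 𝔽₂.
  V : Set
  V = Fin n → Bool

  α : Fin n → V
  α s t with s Data.Fin.≟ t
  ... | Relation.Nullary.yes _ = true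
  ... | Relation.Nullary.no _  = false

∑ : ∀ {n} → (Fin n → Bool) → Bool
∑ {zero}  f = false
∑ {suc n} f = f zero xor ∑ (λ i → f (suc i))

module _ {n : ℕ} where

  -- bilinear form B(α_s, α_t) = [st ∈ R], extended bilinearly
  B : Rel n → V {n} → V {n} → Bool
  B E v w = ∑ λ s → ∑ λ t → v s ∧ w t ∧ E s t

  θ : Rel n → V {n} → (V {n} → Bool)
  θ E v = λ w → B E v w

  f : Fin n → (V {n} → Bool)
  f s v = v s

-- Expanding B, θ(w)(v) = Σ_j v_j · #{i ∈ A_s : i adjacent to j} (mod 2), so it suffices that s has
-- an odd and every j ≠ s an even number of neighbours in A_s. Reading alternating paths backwards,
-- t ∈ A_s iff s ∈ A_t, so paths may be extended at the t end. The only A_s-neighbour of s is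
-- its mate. For j ≠ s, a neighbour i ∈ A_s with i not matched to j extends its path by the
-- unmatched edge i–j and the matched edge j–mate j, putting mate j in A_s; conversely the path of
-- mate j ∈ A_s passes through j to such an i. Since paths in a tree are unique there is at most
-- one such i, so the A_s-neighbours of j are either none or exactly i and mate j.

module Submission where

open import Defs
open import Data.Nat using (ℕ; zero; suc; s≤s; z≤n)
open import Data.Fin using (Fin; zero; suc; _≟_)
open import Data.Fin.Properties using (suc-injective)
open import Data.Bool using (Bool; true; false; not; _∧_; _xor_)
open import Data.Bool.Properties
  using (xor-identityʳ; ∧-distribˡ-xor; ∧-zeroʳ; ∧-identityʳ; not-involutive; not-injective;
         xor-∧-commutativeRing)
open import Data.List using (List; []; _∷_; _++_; _∷ʳ_; _ʳ++_; reverse; head; last)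
open import Data.List.Properties using (∷-injectiveˡ; ∷-injectiveʳ)
open import Data.List.Relation.Unary.All using ([]; _∷_)
open import Data.List.Relation.Unary.All.Properties as All using (¬Any⇒All¬)
open import Data.List.Relation.Unary.Any using (here; there)
open import Data.List.Relation.Unary.AllPairs using ([]; _∷_)
open import Data.List.Relation.Unary.Unique.Propositional using (Unique)
open import Data.List.Relation.Unary.Unique.Propositional.Properties using (Unique[x∷xs]⇒x∉xs)
open import Data.List.Membership.Propositional using (_∈_; _∉_)
open import Data.List.Membership.Propositional.Properties using (∈-∃++)
open import Data.List.Relation.Binary.Permutation.Propositional using (↭-sym; ↭⇒↭ₛ)
open import Data.List.Relation.Binary.Permutation.Propositional.Properties using (↭-reverse)
open import Data.Maybe using (just)
open import Data.Maybe.Properties using (just-injective)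
open import Data.Product using (Σ; _×_; _,_; proj₁; proj₂)
open import Data.Unit using (tt)
open import Data.Empty using (⊥; ⊥-elim)
open import Algebra.Bundles using (CommutativeRing)
open import Algebra.Properties.CommutativeSemigroup
  (CommutativeRing.+-commutativeSemigroup xor-∧-commutativeRing) using (interchange)
open import Relation.Binary.PropositionalEquality
  using (_≡_; _≢_; refl; sym; trans; cong; cong₂; subst; setoid; module ≡-Reasoning)
open import Relation.Nullary using (yes; no)
open import Function.Base using (_∘_; case_of_)
open import Function.Bundles using (_⇔_; Equivalence)

private
  variable
    n : ℕ

∑-cong : {g h : Fin n → Bool} → (∀ i → g i ≡ h i) → ∑ g ≡ ∑ h
∑-cong {zero}  g≗h = refl
∑-cong {suc n} g≗h = cong₂ _xor_ (g≗h zero) (∑-cong (λ i → g≗h (suc i)))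

∑-zero : (g : Fin n → Bool) → (∀ i → g i ≡ false) → ∑ g ≡ false
∑-zero {zero}  g g≗0 = refl
∑-zero {suc n} g g≗0 = cong₂ _xor_ (g≗0 zero) (∑-zero (λ i → g (suc i)) (λ i → g≗0 (suc i)))

∑-xor : (g h : Fin n → Bool) → ∑ (λ i → g i xor h i) ≡ ∑ g xor ∑ h
∑-xor {zero}  g h = refl
∑-xor {suc n} g h =
  trans (cong ((g zero xor h zero) xor_) (∑-xor (λ i → g (suc i)) (λ i → h (suc i))))
        (interchange (g zero) (h zero) _ _)

∑-swap : ∀ {m} (F : Fin m → Fin n → Bool) →
  ∑ (λ i → ∑ (λ j → F i j)) ≡ ∑ (λ j → ∑ (λ i → F i j))
∑-swap {n} {zero}  F = sym (∑-zero {n} _ (λ _ → refl))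
∑-swap {m = suc m}  F =
  trans (cong (∑ (F zero) xor_) (∑-swap (λ i → F (suc i))))
        (sym (∑-xor (F zero) (λ j → ∑ (λ i → F (suc i) j))))

∑-∧ˡ : ∀ b (g : Fin n → Bool) → ∑ (λ i → b ∧ g i) ≡ b ∧ ∑ g
∑-∧ˡ {zero}  b g = sym (∧-zeroʳ b)
∑-∧ˡ {suc n} b g =
  trans (cong ((b ∧ g zero) xor_) (∑-∧ˡ b (λ i → g (suc i))))
        (sym (∧-distribˡ-xor b (g zero) _))

∑-single : (k : Fin n) (g : Fin n → Bool) → (∀ i → i ≢ k → g i ≡ false) → ∑ g ≡ g k
∑-single zero g g≗0 =
  trans (cong (g zero xor_) (∑-zero _ (λ i → g≗0 (suc i) (λ ())))) (xor-identityʳ _)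
∑-single (suc k) g g≗0 =
  trans (cong (_xor ∑ (λ i → g (suc i))) (g≗0 zero (λ ())))
        (∑-single k (λ i → g (suc i)) (λ i i≢k → g≗0 (suc i) (i≢k ∘ suc-injective)))

∑-pair : (k₁ k₂ : Fin n) (g : Fin n → Bool) → k₁ ≢ k₂ → g k₁ ≡ true → g k₂ ≡ true →
  (∀ i → i ≢ k₁ → i ≢ k₂ → g i ≡ false) → ∑ g ≡ false
∑-pair zero zero g k₁≢k₂ _ _ _ = ⊥-elim (k₁≢k₂ refl)
∑-pair zero (suc k₂) g _ g₁ g₂ g≗0 =
  cong₂ _xor_ g₁ (trans (∑-single k₂ _ (λ i i≢k₂ → g≗0 (suc i) (λ ()) (i≢k₂ ∘ suc-injective))) g₂)
∑-pair (suc k₁) zero g _ g₁ g₂ g≗0 =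
  cong₂ _xor_ g₂ (trans (∑-single k₁ _ (λ i i≢k₁ → g≗0 (suc i) (i≢k₁ ∘ suc-injective) (λ ()))) g₁)
∑-pair (suc k₁) (suc k₂) g k₁≢k₂ g₁ g₂ g≗0 =
  cong₂ _xor_ (g≗0 zero (λ ()) (λ ()))
    (∑-pair k₁ k₂ (λ i → g (suc i)) (k₁≢k₂ ∘ cong suc) g₁ g₂
      (λ i i≢k₁ i≢k₂ → g≗0 (suc i) (i≢k₁ ∘ suc-injective) (i≢k₂ ∘ suc-injective)))

∧≡false : ∀ {a b} → (a ≡ true → b ≡ true → ⊥) → a ∧ b ≡ false
∧≡false {true}  {true}  a∧b≢true = ⊥-elim (a∧b≢true refl refl)
∧≡false {true}  {false} _ = refl
∧≡false {false}         _ = refl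

α-diag : (s : Fin n) → α s s ≡ true
α-diag s with s ≟ s
... | yes _   = refl
... | no s≢s = ⊥-elim (s≢s refl)

α-off : {s t : Fin n} → s ≢ t → α s t ≡ false
α-off {s = s} {t} s≢t with s ≟ t
... | yes s≡t = ⊥-elim (s≢t s≡t)
... | no _    = refl

θ-transpose : (E : Rel n) (w v : V) → θ E w v ≡ ∑ (λ j → v j ∧ ∑ (λ i → w i ∧ E i j))
θ-transpose E w v = begin
  ∑ (λ i → ∑ (λ j → w i ∧ v j ∧ E i j))   ≡⟨ ∑-swap (λ i j → w i ∧ v j ∧ E i j) ⟩
  ∑ (λ j → ∑ (λ i → w i ∧ v j ∧ E i j))   ≡⟨ ∑-cong (λ j → ∑-cong (λ i → exchange (w i) (v j) _)) ⟩
  ∑ (λ j → ∑ (λ i → v j ∧ w i ∧ E i j))   ≡⟨ ∑-cong (λ j → ∑-∧ˡ (v j) (λ i → w i ∧ E i j)) ⟩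
  ∑ (λ j → v j ∧ ∑ (λ i → w i ∧ E i j))   ∎
  where
  open ≡-Reasoning
  exchange : ∀ a b c → a ∧ b ∧ c ≡ b ∧ a ∧ c
  exchange true  b c = refl
  exchange false b c = sym (∧-zeroʳ b)

θ≡f : (E : Rel n) (s : Fin n) (w : V) → (∀ j → ∑ (λ i → w i ∧ E i j) ≡ α s j) →
  ∀ v → θ E w v ≡ f s v
θ≡f E s w Ew≡αs v = begin
  θ E w v                                  ≡⟨ θ-transpose E w v ⟩
  ∑ (λ j → v j ∧ ∑ (λ i → w i ∧ E i j))   ≡⟨ ∑-cong (λ j → cong (v j ∧_) (Ew≡αs j)) ⟩
  ∑ (λ j → v j ∧ α s j)                    ≡⟨ ∑-single s _ off-s ⟩
  v s ∧ α s s                              ≡⟨ cong (v s ∧_) (α-diag s) ⟩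
  v s ∧ true                               ≡⟨ ∧-identityʳ (v s) ⟩
  v s                                      ∎
  where
  open ≡-Reasoning
  off-s : ∀ j → j ≢ s → v j ∧ α s j ≡ false
  off-s j j≢s = trans (cong (v j ∧_) (α-off (λ s≡j → j≢s (sym s≡j)))) (∧-zeroʳ (v j))

module _ {A : Set} where

  last-∈ : ∀ (xs : List A) {y} → last xs ≡ just y → y ∈ xs
  last-∈ (x ∷ [])     refl = here refl
  last-∈ (x ∷ x′ ∷ xs) eq  = there (last-∈ (x′ ∷ xs) eq)

  head-ʳ++ : ∀ (xs : List A) {acc y} → last xs ≡ just y → head (xs ʳ++ acc) ≡ just y
  head-ʳ++ (x ∷ [])      refl = refl
  head-ʳ++ (x ∷ x′ ∷ xs) eq   = head-ʳ++ (x′ ∷ xs) eq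

  last-ʳ++ : ∀ (xs : List A) x acc → last (xs ʳ++ (x ∷ acc)) ≡ last (x ∷ acc)
  last-ʳ++ []       x acc = refl
  last-ʳ++ (y ∷ xs) x acc = last-ʳ++ xs y (x ∷ acc)

  Unique-reverse : ∀ {xs : List A} → Unique xs → Unique (reverse xs)
  Unique-reverse {xs} = Unique-resp-↭ (↭⇒↭ₛ (↭-sym (↭-reverse xs)))
    where
    open import Data.List.Relation.Binary.Permutation.Setoid.Properties (setoid A)
      using (Unique-resp-↭)

  Unique-pivot : ∀ (xs : List A) {z ys} → Unique (xs ++ z ∷ ys) → Unique (z ∷ xs)
  Unique-pivot []       _ = [] ∷ []
  Unique-pivot (x ∷ xs) (x∉ ∷ u) with Unique-pivot xs u | All.++⁻ʳ xs x∉
  ... | z∉xs ∷ uxs | x≢z ∷ _ = ((λ z≡x → x≢z (sym z≡x)) ∷ z∉xs) ∷ All.++⁻ˡ xs x∉ ∷ uxs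

module Reversal (R : Rel n) (R-sym : ∀ s t → R s t ≡ R t s) where

  R-flip : ∀ {s t} → R s t ≡ true → R t s ≡ true
  R-flip {s} {t} Rst = trans (R-sym t s) Rst

  Consecutive-ʳ++ : ∀ x xs acc → Consecutive R (x ∷ xs) → Consecutive R (x ∷ acc) →
    Consecutive R ((x ∷ xs) ʳ++ acc)
  Consecutive-ʳ++ x []       acc _          c-acc = c-acc
  Consecutive-ʳ++ x (y ∷ xs) acc (Rxy , c) c-acc =
    Consecutive-ʳ++ y xs (x ∷ acc) c (R-flip Rxy , c-acc)

  Consecutive-reverse : ∀ xs → Consecutive R xs → Consecutive R (reverse xs)
  Consecutive-reverse []       _ = tt
  Consecutive-reverse (x ∷ xs) c = Consecutive-ʳ++ x xs [] c tt

  Alternating-ʳ++ : ∀ x y xs acc → Alternating R (x ∷ y ∷ xs) → Alternating R (y ∷ x ∷ acc) →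
    Alternating R ((x ∷ y ∷ xs) ʳ++ acc)
  Alternating-ʳ++ x y []       acc _            a-acc = a-acc
  Alternating-ʳ++ x y (z ∷ xs) acc (alt , a) a-acc =
    Alternating-ʳ++ y z xs (x ∷ acc) a (flipped , a-acc)
    where
    flipped : R z y ≡ not (R y x)
    flipped = begin
      R z y             ≡⟨ R-sym z y ⟩
      R y z             ≡⟨ not-involutive (R y z) ⟨
      not (not (R y z)) ≡⟨ cong not alt ⟨
      not (R x y)       ≡⟨ cong not (R-sym x y) ⟩
      not (R y x)       ∎
      where open ≡-Reasoning

  Alternating-reverse : ∀ xs → Alternating R xs → Alternating R (reverse xs)
  Alternating-reverse []           _ = tt
  Alternating-reverse (x ∷ [])     _ = tt
  Alternating-reverse (x ∷ y ∷ xs) a = Alternating-ʳ++ x y xs [] a tt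

  LastEdgeIn-ʳ++ : ∀ xs acc → LastEdgeIn R acc → LastEdgeIn R (xs ʳ++ acc)
  LastEdgeIn-ʳ++ []       acc          l = l
  LastEdgeIn-ʳ++ (x ∷ xs) (y ∷ z ∷ acc) l = LastEdgeIn-ʳ++ xs (x ∷ y ∷ z ∷ acc) l

  LastEdgeIn⇒FirstEdgeIn-ʳ++ : ∀ xs acc → LastEdgeIn R xs → FirstEdgeIn R (xs ʳ++ acc)
  LastEdgeIn⇒FirstEdgeIn-ʳ++ (x ∷ y ∷ [])     acc l = R-flip l
  LastEdgeIn⇒FirstEdgeIn-ʳ++ (x ∷ y ∷ z ∷ xs) acc l =
    LastEdgeIn⇒FirstEdgeIn-ʳ++ (y ∷ z ∷ xs) (x ∷ acc) l

  FirstEdgeIn⇒LastEdgeIn-reverse : ∀ xs → FirstEdgeIn R xs → LastEdgeIn R (reverse xs)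
  FirstEdgeIn⇒LastEdgeIn-reverse (x ∷ y ∷ xs) f = LastEdgeIn-ʳ++ xs (y ∷ x ∷ []) (R-flip f)

  IsPath-reverse : ∀ {s t} p → IsPath R s t p → IsPath R t s (reverse p)
  IsPath-reverse (x ∷ xs) (u , c , refl , l) =
    Unique-reverse u , Consecutive-reverse (x ∷ xs) c , head-ʳ++ (x ∷ xs) l , last-ʳ++ xs x []

InA-sym : (E P : Rel n) → (∀ s t → E s t ≡ E t s) → (∀ s t → P s t ≡ P t s) →
  ∀ {s t} → InA E P s t → InA E P t s
InA-sym E P E-sym P-sym (t≢s , p , path , alt , first , lst) =
  (λ s≡t → t≢s (sym s≡t)) , reverse p , IsPath-reverse p path ,
  Alternating-reverse p alt , LastEdgeIn⇒FirstEdgeIn-ʳ++ p [] lst ,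
  FirstEdgeIn⇒LastEdgeIn-reverse p first
  where
  open Reversal E E-sym using (IsPath-reverse)
  open Reversal P P-sym
    using (Alternating-reverse; LastEdgeIn⇒FirstEdgeIn-ʳ++; FirstEdgeIn⇒LastEdgeIn-reverse)

Consecutive-prefix : (R : Rel n) (xs : List (Fin n)) {z : Fin n} {ys : List (Fin n)} →
  Consecutive R (xs ++ z ∷ ys) → Consecutive R (xs ∷ʳ z)
Consecutive-prefix R []            c       = tt
Consecutive-prefix R (x ∷ [])      (e , _) = e , tt
Consecutive-prefix R (x ∷ x′ ∷ xs) (e , c) = e , Consecutive-prefix R (x′ ∷ xs) c

IsPath-∷ : (E : Rel n) {i j t : Fin n} (p : List (Fin n)) → IsPath E i t p → E j i ≡ true → j ∉ p →
  IsPath E j t (j ∷ p)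
IsPath-∷ E (i ∷ p) (u , c , refl , l) Eji j∉p = ¬Any⇒All¬ _ j∉p ∷ u , (Eji , c) , refl , l

IsPath-tail : (E : Rel n) {x y t : Fin n} (p : List (Fin n)) →
  IsPath E x t (x ∷ y ∷ p) → IsPath E y t (y ∷ p)
IsPath-tail E p (_ ∷ u , (_ , c) , refl , l) = u , c , refl , l

IsPath-ends-≢ : (E : Rel n) {x y t : Fin n} (p : List (Fin n)) → IsPath E x t (x ∷ y ∷ p) → t ≢ x
IsPath-ends-≢ E p (u , _ , refl , l) t≡x =
  Unique[x∷xs]⇒x∉xs u (subst (_∈ _ ∷ p) t≡x (last-∈ (_ ∷ p) l))

module Tree {n} {E : Rel n} (E-sym : ∀ s t → E s t ≡ E t s) (acyclic : Acyclic E) where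

  open import Data.List.Membership.DecPropositional (_≟_ {n}) using (_∈?_)

  E-flip : ∀ {s t} → E s t ≡ true → E t s ≡ true
  E-flip {s} {t} Est = trans (E-sym t s) Est

  -- The chord z–x closes the cycle z, x, y, …, z.
  no-chord : ∀ {x y z ys} → Unique (x ∷ y ∷ ys) → Consecutive E (x ∷ y ∷ ys) → z ∈ ys →
    E z x ≡ true → ⊥
  no-chord {x} {y} {z} u c z∈ys Ezx with ∈-∃++ z∈ys
  ... | ys₁ , ys₂ , refl =
    acyclic (z ∷ x ∷ y ∷ ys₁)
      (s≤s (s≤s (s≤s z≤n)) , Unique-pivot (x ∷ y ∷ ys₁) u ,
       Ezx , Consecutive-prefix E (x ∷ y ∷ ys₁) c)

  neighbour-on-path : ∀ {x z t xs} → IsPath E x t (x ∷ xs) → z ∈ xs → E x z ≡ true →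
    head xs ≡ just z
  neighbour-on-path {xs = y ∷ ys} _           (here refl)  _   = refl
  neighbour-on-path {xs = y ∷ ys} (u , c , _) (there z∈ys) Exz =
    ⊥-elim (no-chord u c z∈ys (E-flip Exz))

  -- If the second vertices a and b differ, either a lies further along the other path (a chord)
  -- or a, x, b, … is a second path from a.
  path-unique-∷ : ∀ {x a b t} p′ q′ →
    (∀ q → IsPath E a t (a ∷ p′) → IsPath E a t q → a ∷ p′ ≡ q) →
    IsPath E x t (x ∷ a ∷ p′) → IsPath E x t (x ∷ b ∷ q′) → x ∷ a ∷ p′ ≡ x ∷ b ∷ q′
  path-unique-∷ {x} {a} {b} p′ q′ ih (xu ∷ u , (Exa , c) , _ , lp) (xv ∷ v , (Exb , d) , _ , lq)
    with a ≟ b | a ∈? q′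
  ... | yes refl | _         = cong (x ∷_) (ih (a ∷ q′) (u , c , refl , lp) (v , d , refl , lq))
  ... | no _     | yes a∈q′ = ⊥-elim (no-chord (xv ∷ v) (Exb , d) a∈q′ (E-flip Exa))
  ... | no a≢b   | no a∉q′  =
    ⊥-elim (Unique[x∷xs]⇒x∉xs (xu ∷ u) (subst (x ∈_) (sym detour) (there (here refl))))
    where
    a∉ : a ∉ x ∷ b ∷ q′
    a∉ (here a≡x)           = Unique[x∷xs]⇒x∉xs (xu ∷ u) (here (sym a≡x))
    a∉ (there (here a≡b))   = a≢b a≡b
    a∉ (there (there a∈q′)) = a∉q′ a∈q′
    detour : a ∷ p′ ≡ a ∷ x ∷ b ∷ q′
    detour = ih (a ∷ x ∷ b ∷ q′) (u , c , refl , lp)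
      (¬Any⇒All¬ _ a∉ ∷ xv ∷ v , (E-flip Exa , Exb , d) , refl , lq)

  path-unique : ∀ {x t} p q → IsPath E x t p → IsPath E x t q → p ≡ q
  path-unique (x ∷ []) (y ∷ [])      (_ , _ , refl , _) (_ , _ , refl , _) = refl
  path-unique (x ∷ []) (y ∷ b ∷ q′)  (_ , _ , refl , refl) pq@(_ , _ , refl , _) =
    ⊥-elim (IsPath-ends-≢ E q′ pq refl)
  path-unique (x ∷ a ∷ p′) (y ∷ [])  pp@(_ , _ , refl , _) (_ , _ , refl , refl) =
    ⊥-elim (IsPath-ends-≢ E p′ pp refl)
  path-unique (x ∷ a ∷ p′) (y ∷ b ∷ q′) pp@(_ , _ , refl , _) pq@(_ , _ , refl , _) =
    path-unique-∷ p′ q′ (path-unique (a ∷ p′)) pp pq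

module Matching {n} {E P : Rel n} (E-irrefl : ∀ s → E s s ≡ false) (P-sym : ∀ s t → P s t ≡ P t s)
  (P⊆E : ∀ s t → P s t ≡ true → E s t ≡ true)
  (perfect : ∀ s → Σ (Fin n) λ t → (P s t ≡ true) × (∀ u → P s u ≡ true → u ≡ t)) where

  mate : Fin n → Fin n
  mate x = proj₁ (perfect x)

  P-mate : ∀ x → P x (mate x) ≡ true
  P-mate x = proj₁ (proj₂ (perfect x))

  P⇒≡mate : ∀ {x y} → P x y ≡ true → y ≡ mate x
  P⇒≡mate {x} Pxy = proj₂ (proj₂ (perfect x)) _ Pxy

  P-flip : ∀ {x y} → P x y ≡ true → P y x ≡ true
  P-flip {x} {y} Pxy = trans (P-sym y x) Pxy

  mate-involutive : ∀ x → mate (mate x) ≡ x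
  mate-involutive x = sym (P⇒≡mate (P-flip (P-mate x)))

  mate-swap : ∀ {x y} → mate x ≡ y → mate y ≡ x
  mate-swap refl = mate-involutive _

  E-mate : ∀ x → E x (mate x) ≡ true
  E-mate x = P⊆E x (mate x) (P-mate x)

  no-loop : ∀ {x} → E x x ≡ true → ⊥
  no-loop {x} Exx with trans (sym Exx) (E-irrefl x)
  ... | ()

  mate≢ : ∀ x → mate x ≢ x
  mate≢ x mx≡x = no-loop (subst (λ y → E x y ≡ true) mx≡x (E-mate x))

  P-off-mate : ∀ {x y} → mate x ≢ y → P x y ≡ false
  P-off-mate {x} {y} mx≢y with P x y in Pxy
  ... | true  = ⊥-elim (mx≢y (sym (P⇒≡mate Pxy)))
  ... | false = refl

-- Membership t ∈ A_s is used in the form InA E P t s (equivalent by InA-sym), whose paths run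
-- from t back to s and so are extended at t by consing.
module AlternatingPaths {n} {E P : Rel n}
  (E-sym : ∀ s t → E s t ≡ E t s) (E-irrefl : ∀ s → E s s ≡ false) (acyclic : Acyclic E)
  (P-sym : ∀ s t → P s t ≡ P t s) (P⊆E : ∀ s t → P s t ≡ true → E s t ≡ true)
  (perfect : ∀ s → Σ (Fin n) λ t → (P s t ≡ true) × (∀ u → P s u ≡ true → u ≡ t))
  (s : Fin n) where

  open Tree E-sym acyclic
  open Matching E-irrefl P-sym P⊆E perfect

  mate-∈A : InA E P (mate s) s
  mate-∈A =
    IsPath-ends-≢ E [] path , mate s ∷ s ∷ [] , path , tt , P-flip (P-mate s) , P-flip (P-mate s)
    where
    path : IsPath E (mate s) s (mate s ∷ s ∷ [])
    path = ((mate≢ s ∷ []) ∷ [] ∷ []) , (E-flip (E-mate s) , tt) , refl , refl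

  ∈A-neighbour-of-root : ∀ {i} → InA E P i s → E i s ≡ true → i ≡ mate s
  ∈A-neighbour-of-root (s≢i , i ∷ [] , (_ , _ , refl , refl) , _) _ = ⊥-elim (s≢i refl)
  ∈A-neighbour-of-root (_ , i ∷ s ∷ [] , (_ , _ , refl , refl) , _ , Pis , _) _ =
    sym (mate-swap (sym (P⇒≡mate Pis)))
  ∈A-neighbour-of-root (_ , i ∷ y ∷ z ∷ p , (u , c , refl , l) , _) Eis =
    ⊥-elim (no-chord u c (last-∈ (z ∷ p) l) (E-flip Eis))

  ∉-alternating-path : ∀ {i j t} p → IsPath E i t p → FirstEdgeIn P p → E i j ≡ true → mate i ≢ j →
    j ∉ p
  ∉-alternating-path (i ∷ y ∷ p) (_ , _ , refl , _) _ Eij _ (here refl) = no-loop Eij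
  ∉-alternating-path (i ∷ y ∷ p) path@(_ , _ , refl , _) Piy Eij mi≢j (there j∈) =
    mi≢j (trans (sym (P⇒≡mate Piy)) (just-injective (neighbour-on-path path j∈ Eij)))

  ∈A-extend : ∀ {i j} → InA E P i s → E i j ≡ true → mate i ≢ j → InA E P (mate j) s
  ∈A-extend {j = j} (_ , i ∷ y ∷ p , path@(_ , _ , refl , _) , alt , Piy , lst) Eij mi≢j =
    IsPath-ends-≢ E _ mj-path , mate j ∷ j ∷ i ∷ y ∷ p , mj-path ,
    (trans (P-flip (P-mate j)) (cong not (sym Pji)) , trans Pji (cong not (sym Piy)) , alt) ,
    P-flip (P-mate j) , lst
    where
    j-path : IsPath E j s (j ∷ i ∷ y ∷ p)
    j-path = IsPath-∷ E _ path (E-flip Eij) (∉-alternating-path _ path Piy Eij mi≢j)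
    mj∉ : mate j ∉ j ∷ i ∷ y ∷ p
    mj∉ (here mj≡j)    = mate≢ j mj≡j
    mj∉ (there mj∈ip) =
      mi≢j (mate-swap (sym (just-injective (neighbour-on-path j-path mj∈ip (E-mate j)))))
    mj-path : IsPath E (mate j) s (mate j ∷ j ∷ i ∷ y ∷ p)
    mj-path = IsPath-∷ E _ j-path (E-flip (E-mate j)) mj∉
    Pji : P j i ≡ false
    Pji = P-off-mate (λ mj≡i → mi≢j (mate-swap mj≡i))

  -- The A_s-path of mate j runs mate j, j, k, …, and k is then a second A_s-neighbour of j.
  ∈A-retract : ∀ {j} → j ≢ s → InA E P (mate j) s →
    Σ (Fin n) λ k → InA E P k s × E k j ≡ true × mate k ≢ j
  ∈A-retract {j} j≢s (_ , _ ∷ y ∷ p , (_ , _ , refl , _) , _ , Pmy , _)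
    with trans (P⇒≡mate Pmy) (mate-involutive j)
  ∈A-retract j≢s (_ , _ ∷ _ ∷ [] , (_ , _ , _ , l) , _) | refl = ⊥-elim (j≢s (just-injective l))
  ∈A-retract {j} j≢s (_ , _ ∷ _ ∷ k ∷ [] , _ , (alt , _) , _ , Pjk) | refl
    with trans (sym (P-flip (P-mate j))) (trans alt (cong not Pjk))
  ... | ()
  ∈A-retract {j} j≢s
    (_ , _ ∷ _ ∷ k ∷ l ∷ p , path@(_ , (_ , Ejk , _) , _) , (alt₁ , alt₂ , alt) , _ , lst) | refl =
    k , (IsPath-ends-≢ E p k-path , k ∷ l ∷ p , k-path , alt , Pkl , lst) , E-flip Ejk , mk≢j
    where
    k-path : IsPath E k s (k ∷ l ∷ p)
    k-path = IsPath-tail E _ (IsPath-tail E _ path)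
    Pjk : P j k ≡ false
    Pjk = not-injective (sym (trans (sym (P-flip (P-mate j))) alt₁))
    Pkl : P k l ≡ true
    Pkl = not-injective (sym (trans (sym Pjk) alt₂))
    mk≢j : mate k ≢ j
    mk≢j mk≡j = case trans (sym (P-flip (subst (λ x → P k x ≡ true) mk≡j (P-mate k)))) Pjk of λ ()

  ∈A-neighbours-unique : ∀ {i k j} → InA E P i s → InA E P k s → E i j ≡ true → E k j ≡ true →
    mate i ≢ j → mate k ≢ j → i ≡ k
  ∈A-neighbours-unique {j = j} (_ , p@(_ ∷ _) , p-path@(_ , _ , refl , _) , _ , Pp , _)
    (_ , q@(_ ∷ _) , q-path@(_ , _ , refl , _) , _ , Pq , _) Eij Ekj mi≢j mk≢j =
    ∷-injectiveˡ (∷-injectiveʳ (path-unique (j ∷ p) (j ∷ q)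
      (IsPath-∷ E p p-path (E-flip Eij) (∉-alternating-path p p-path Pp Eij mi≢j))
      (IsPath-∷ E q q-path (E-flip Ekj) (∉-alternating-path q q-path Pq Ekj mk≢j))))

  module _ (w : V {n}) (w⇔A : ∀ t → (w t ≡ true) ⇔ InA E P s t) where

    ∈A⇒w : ∀ {t} → InA E P t s → w t ≡ true
    ∈A⇒w t∈A = Equivalence.from (w⇔A _) (InA-sym E P E-sym P-sym t∈A)

    w⇒∈A : ∀ {t} → w t ≡ true → InA E P t s
    w⇒∈A wt = InA-sym E P E-sym P-sym (Equivalence.to (w⇔A _) wt)

    ∑-A-neighbours-root : ∑ (λ i → w i ∧ E i s) ≡ true
    ∑-A-neighbours-root = begin
      ∑ (λ i → w i ∧ E i s)      ≡⟨ ∑-single (mate s) _ others ⟩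
      w (mate s) ∧ E (mate s) s  ≡⟨ cong₂ _∧_ (∈A⇒w mate-∈A) (E-flip (E-mate s)) ⟩
      true                       ∎
      where
      open ≡-Reasoning
      others : ∀ i → i ≢ mate s → w i ∧ E i s ≡ false
      others i i≢ms = ∧≡false (λ wi Eis → i≢ms (∈A-neighbour-of-root (w⇒∈A wi) Eis))

    ∑-A-neighbours-off-root : ∀ {j} → j ≢ s → ∑ (λ i → w i ∧ E i j) ≡ false
    ∑-A-neighbours-off-root {j} j≢s with w (mate j) in wmj
    ... | false =
      ∑-zero (λ i → w i ∧ E i j) (λ i → ∧≡false λ wi Eij → case trans (sym (w-mate wi Eij)) wmj of λ ())
      where
      w-mate : ∀ {i} → w i ≡ true → E i j ≡ true → w (mate j) ≡ true
      w-mate {i} wi Eij with mate i ≟ j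
      ... | yes mi≡j = subst (λ x → w x ≡ true) (sym (mate-swap mi≡j)) wi
      ... | no mi≢j  = ∈A⇒w (∈A-extend (w⇒∈A wi) Eij mi≢j)
    ... | true with ∈A-retract j≢s (w⇒∈A wmj)
    ...   | k , k∈A , Ekj , mk≢j =
      ∑-pair k (mate j) _ (λ k≡mj → mk≢j (mate-swap (sym k≡mj)))
        (cong₂ _∧_ (∈A⇒w k∈A) Ekj) (cong₂ _∧_ wmj (E-flip (E-mate j))) others
      where
      others : ∀ i → i ≢ k → i ≢ mate j → w i ∧ E i j ≡ false
      others i i≢k i≢mj = ∧≡false λ wi Eij → case mate i ≟ j of λ where
        (yes mi≡j) → i≢mj (sym (mate-swap mi≡j))
        (no mi≢j)  → i≢k (∈A-neighbours-unique (w⇒∈A wi) k∈A Eij Ekj mi≢j mk≢j)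

    ∑-A-neighbours : ∀ j → ∑ (λ i → w i ∧ E i j) ≡ α s j
    ∑-A-neighbours j with s ≟ j
    ... | yes refl = ∑-A-neighbours-root
    ... | no s≢j   = ∑-A-neighbours-off-root (λ j≡s → s≢j (sym j≡s))

lemma4p5 : (n : ℕ) (E P : Rel n) → IsTree E → IsPerfectMatching E P →
    (s : Fin n) (αsᵛ : V {n}) → (∀ t → (αsᵛ t ≡ true) ⇔ InA E P s t) →
    ∀ (v : V {n}) → θ E αsᵛ v ≡ f s v
lemma4p5 n E P ((E-sym , E-irrefl) , _ , acyclic) (P-sym , P⊆E , perfect) s αsᵛ αsᵛ⇔A =
  θ≡f E s αsᵛ (∑-A-neighbours αsᵛ αsᵛ⇔A)
  where open AlternatingPaths E-sym E-irrefl acyclic P-sym P⊆E perfect s
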